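{- Let $p$ be a prime and let $A=(a_1,\dots,a_\ell)$ be a sequence of $\ell\geqslant p-1$ nonzero elements of $\mathbb{F}_p$. Then for every $\alpha\in\mathbb{F}_p$ there exists $I\subseteq[1,\ell]$ such that $\dim(A,\alpha)=\dim(A_I)$.
   Context: For $\alpha\in\mathbb{F}_p$, $\mathcal{S}^\alpha_A=\{x\in\{0,1\}^\ell : a_1x_1+\dots+a_\ell x_\ell=\alpha \text{ in } \mathbb{F}_p\}$ and $\dim(A,\alpha)$ is the dimension of the affine hull of $\mathcal{S}^\alpha_A$ in $\mathbb{F}_p^\ell$. For $I\subseteq[1,\ell]$, $A_I=(a'_1,\dots,a'_\ell)$ where $a'_i=-a_i$ if $i\in I$ and $a'_i=a_i$ otherwise. For a sequence $C=(c_1,\dots,c_\ell)$ of nonzero elements, $\dim(C)$ is the dimension of the $\mathbb{F}_p$-linear span of $\mathcal{S}_C=\{x\in\{0,1\}^\ell : \sum_i c_ix_i=0\}$. -}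

module Defs where

open import Data.Nat using (ℕ; zero; suc; _+_; _*_; _∸_; NonZero)
open import Data.Nat.DivMod using (_%_; m%n<n)
open import Data.Fin using (Fin; toℕ; fromℕ<) renaming (zero to fz; suc to fs)
open import Data.Fin.Subset using (Subset)
open import Data.Vec using (lookup)
open import Data.Bool using (Bool; true; false; if_then_else_)
open import Data.Product using (Σ; ∃; _×_)
open import Data.Sum using (_⊎_)
open import Relation.Binary.PropositionalEquality using (_≡_)

-- The prime field 𝔽_p, represented by Fin p with arithmetic mod p.
module _ (p : ℕ) .{{_ : NonZero p}} where

  𝔽 : Set
  𝔽 = Fin p

  ι : ℕ → 𝔽
  ι n = fromℕ< (m%n<n n p)

  0F 1F : 𝔽
  0F = ι 0
  1F = ι 1

  _+F_ _*F_ : 𝔽 → 𝔽 → 𝔽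
  a +F b = ι (toℕ a + toℕ b)
  a *F b = ι (toℕ a * toℕ b)

  -F_ : 𝔽 → 𝔽
  -F a = ι (p ∸ toℕ a)

  ΣF : ∀ {k} → (Fin k → 𝔽) → 𝔽
  ΣF {zero}  f = 0F
  ΣF {suc k} f = f fz +F ΣF (λ i → f (fs i))

  Vecℓ : ℕ → Set
  Vecℓ ℓ = Fin ℓ → 𝔽

  _≈_ : ∀ {ℓ} → Vecℓ ℓ → Vecℓ ℓ → Set
  u ≈ v = ∀ j → u j ≡ v j

  _⊕_ : ∀ {ℓ} → Vecℓ ℓ → Vecℓ ℓ → Vecℓ ℓ
  (u ⊕ v) j = u j +F v j

  0V : ∀ {ℓ} → Vecℓ ℓ
  0V j = 0F

  lincomb : ∀ {ℓ k} → (Fin k → 𝔽) → (Fin k → Vecℓ ℓ) → Vecℓ ℓ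
  lincomb c w j = ΣF (λ i → c i *F w i j)

  InSpan : ∀ {ℓ} → (Vecℓ ℓ → Set) → Vecℓ ℓ → Set
  InSpan {ℓ} P v = Σ ℕ λ k → Σ (Fin k → Vecℓ ℓ) λ w →
    (∀ i → P (w i)) × Σ (Fin k → 𝔽) λ c → v ≈ lincomb c w

  InAffHull : ∀ {ℓ} → (Vecℓ ℓ → Set) → Vecℓ ℓ → Set
  InAffHull {ℓ} P v = Σ ℕ λ k → Σ (Fin k → Vecℓ ℓ) λ w →
    (∀ i → P (w i)) × Σ (Fin k → 𝔽) λ c → (ΣF c ≡ 1F) × (v ≈ lincomb c w)

  LinIndep : ∀ {ℓ d} → (Fin d → Vecℓ ℓ) → Set
  LinIndep b = ∀ c → lincomb c b ≈ 0V → ∀ i → c i ≡ 0F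

  DimSpan : ∀ {ℓ} → (Vecℓ ℓ → Set) → ℕ → Set
  DimSpan {ℓ} P d = Σ (Fin d → Vecℓ ℓ) λ b →
    (∀ i → InSpan P (b i)) × LinIndep b ×
    (∀ v → InSpan P v → Σ (Fin d → 𝔽) λ c → v ≈ lincomb c b)

  -- the affine hull of P has dimension d: it is nonempty, containing some x₀,
  -- and its direction space {u : x₀ + u ∈ aff(P)} has dimension d
  DimAff : ∀ {ℓ} → (Vecℓ ℓ → Set) → ℕ → Set
  DimAff {ℓ} P d = Σ (Vecℓ ℓ) λ x₀ → InAffHull P x₀ ×
    DimSpan (λ u → InAffHull P (u ⊕ x₀)) d

  IsBinary : ∀ {ℓ} → Vecℓ ℓ → Set
  IsBinary x = ∀ i → (x i ≡ 0F) ⊎ (x i ≡ 1F)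

  dot : ∀ {ℓ} → Vecℓ ℓ → Vecℓ ℓ → 𝔽
  dot a x = ΣF (λ i → a i *F x i)

  𝒮 : ∀ {ℓ} → Vecℓ ℓ → 𝔽 → Vecℓ ℓ → Set
  𝒮 a α x = IsBinary x × (dot a x ≡ α)

  DimAα : ∀ {ℓ} → Vecℓ ℓ → 𝔽 → ℕ → Set
  DimAα a α d = DimAff (𝒮 a α) d

  DimC : ∀ {ℓ} → Vecℓ ℓ → ℕ → Set
  DimC c d = DimSpan (𝒮 c 0F) d

  flipI : ∀ {ℓ} → Vecℓ ℓ → Subset ℓ → Vecℓ ℓ
  flipI a I i = if lookup I i then -F (a i) else a i

module Submission where

-- Since ℓ ≥ p - 1, the subset sums of A cover 𝔽_p (each new nonzero element
-- strictly enlarges the set of subset sums unless that set is already everything),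
-- so there is a 0/1 vector x₀ with Σ aᵢx₀ᵢ = α.  Let I be its support and σⱼ = 1 - 2x₀ⱼ.
-- Then y ↦ σ·(y - x₀) maps 𝒮^α_A into 𝒮_{A_I} and t ↦ σ·t + x₀ maps back; since
-- u ↦ σ·u is a linear involution, it carries a basis of span 𝒮_{A_I} to a basis of
-- the direction space of aff 𝒮^α_A.  Finally span 𝒮_{A_I} has a basis at all, found
-- greedily among the finitely many vectors of 𝔽_p^ℓ.

open import Defs
open import Algebra.Bundles using (CommutativeRing)
open import Algebra.Consequences.Propositional using (comm∧idˡ⇒id; comm∧invʳ⇒inv; comm∧distrʳ⇒distrˡ)
import Algebra.Properties.Ring as RingProperties
import Algebra.Properties.Semiring.Sum as SemiringSum
open import Data.Bool using (Bool; true; false; if_then_else_)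
open import Data.Empty using (⊥-elim)
open import Data.Fin using (Fin; toℕ; finToFun; funToFin) renaming (zero to fz; suc to fs)
open import Data.Fin.Properties using (_≟_; any?; all?; toℕ-fromℕ<; toℕ-injective; toℕ<n; finToFun-funToFin)
open import Data.Fin.Subset using (Subset; _∈_; _∉_; _⊂_; _∪_; ⁅_⁆; ∣_∣)
open import Data.Fin.Subset.Properties using (_∈?_; x∈⁅x⁆; x∈⁅y⁆⇒x≡y; ∣⁅x⁆∣≡1; x∈p∪q⁺; x∈p∪q⁻; p⊆p∪q; p⊂q⇒∣p∣<∣q∣; ∣p∣≤n; ∣p∣≡n⇒p≡⊤; ∈⊤)
open import Data.Nat using (ℕ; zero; suc; NonZero; ≢-nonZero; _≤_; _∸_; s≤s)
import Data.Nat as ℕ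
import Data.Nat.Properties as ℕₚ
open import Data.Nat.Coprimality using (prime⇒coprime; coprime-Bézout)
open import Data.Nat.DivMod using (_%_; m%n<n; m<n⇒m%n≡m; n%n≡0; %-distribˡ-+; %-distribˡ-*; [m+kn]%n≡m%n)
open import Data.Nat.GCD using (module Bézout)
open import Data.Nat.Primality using (Prime)
open import Data.Product using (Σ; ∃; _×_; _,_; proj₁; proj₂)
open import Data.Sum using (_⊎_; inj₁; inj₂)
open import Data.Vec using (tabulate; lookup)
open import Data.Vec.Functional using (_∷_)
open import Data.Vec.Properties using (lookup∘tabulate; []=⇒lookup; lookup⇒[]=)
open import Function using (_∘_)
open import Relation.Nullary using (¬_; Dec; yes; no)
open import Relation.Nullary.Decidable using (map′; _×-dec_; _⊎-dec_; ¬?)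
open import Relation.Binary.PropositionalEquality

-- Each ring law is transported along
-- the surjective semiring homomorphism ι : ℕ → 𝔽 p (reduction mod p).
module PrimeField (p : ℕ) .{{_ : NonZero p}} where

  private
    _+_ _*_ : 𝔽 p → 𝔽 p → 𝔽 p
    _+_ = _+F_ p
    _*_ = _*F_ p
    infixl 6 _+_
    infixl 7 _*_
    ⟦_⟧ : ℕ → 𝔽 p
    ⟦_⟧ = ι p

  toℕ-ι : ∀ n → toℕ ⟦ n ⟧ ≡ n % p
  toℕ-ι n = toℕ-fromℕ< (m%n<n n p)

  ι-cong : ∀ {m n} → m % p ≡ n % p → ⟦ m ⟧ ≡ ⟦ n ⟧
  ι-cong {m} {n} m≡n = toℕ-injective (trans (toℕ-ι m) (trans m≡n (sym (toℕ-ι n))))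

  ι-toℕ : ∀ a → ⟦ toℕ a ⟧ ≡ a
  ι-toℕ a = toℕ-injective (trans (toℕ-ι (toℕ a)) (m<n⇒m%n≡m (toℕ<n a)))

  ι-+ : ∀ m n → ⟦ m ℕ.+ n ⟧ ≡ ⟦ m ⟧ + ⟦ n ⟧
  ι-+ m n = ι-cong (begin
    (m ℕ.+ n) % p                          ≡⟨ %-distribˡ-+ m n p ⟩
    (m % p ℕ.+ n % p) % p                  ≡⟨ cong₂ (λ x y → (x ℕ.+ y) % p) (toℕ-ι m) (toℕ-ι n) ⟨
    (toℕ ⟦ m ⟧ ℕ.+ toℕ ⟦ n ⟧) % p          ∎)
    where open ≡-Reasoning

  ι-* : ∀ m n → ⟦ m ℕ.* n ⟧ ≡ ⟦ m ⟧ * ⟦ n ⟧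
  ι-* m n = ι-cong (begin
    (m ℕ.* n) % p                          ≡⟨ %-distribˡ-* m n p ⟩
    (m % p ℕ.* (n % p)) % p                ≡⟨ cong₂ (λ x y → (x ℕ.* y) % p) (toℕ-ι m) (toℕ-ι n) ⟨
    (toℕ ⟦ m ⟧ ℕ.* toℕ ⟦ n ⟧) % p          ∎)
    where open ≡-Reasoning

  ι-elim : (P : 𝔽 p → Set) → (∀ n → P ⟦ n ⟧) → ∀ a → P a
  ι-elim P P⟦⟧ a = subst P (ι-toℕ a) (P⟦⟧ (toℕ a))

  ι-elim₃ : (P : 𝔽 p → 𝔽 p → 𝔽 p → Set) → (∀ m n k → P ⟦ m ⟧ ⟦ n ⟧ ⟦ k ⟧) → ∀ a b c → P a b c
  ι-elim₃ P P⟦⟧ = ι-elim _ λ m → ι-elim _ λ n → ι-elim _ λ k → P⟦⟧ m n k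

  open ≡-Reasoning

  +-assoc : ∀ a b c → (a + b) + c ≡ a + (b + c)
  +-assoc = ι-elim₃ (λ a b c → (a + b) + c ≡ a + (b + c)) λ m n k → begin
    (⟦ m ⟧ + ⟦ n ⟧) + ⟦ k ⟧   ≡⟨ cong (_+ ⟦ k ⟧) (ι-+ m n) ⟨
    ⟦ m ℕ.+ n ⟧ + ⟦ k ⟧       ≡⟨ ι-+ (m ℕ.+ n) k ⟨
    ⟦ m ℕ.+ n ℕ.+ k ⟧         ≡⟨ cong ⟦_⟧ (ℕₚ.+-assoc m n k) ⟩
    ⟦ m ℕ.+ (n ℕ.+ k) ⟧       ≡⟨ ι-+ m (n ℕ.+ k) ⟩
    ⟦ m ⟧ + ⟦ n ℕ.+ k ⟧       ≡⟨ cong (⟦ m ⟧ +_) (ι-+ n k) ⟩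
    ⟦ m ⟧ + (⟦ n ⟧ + ⟦ k ⟧)   ∎

  *-assoc : ∀ a b c → (a * b) * c ≡ a * (b * c)
  *-assoc = ι-elim₃ (λ a b c → (a * b) * c ≡ a * (b * c)) λ m n k → begin
    (⟦ m ⟧ * ⟦ n ⟧) * ⟦ k ⟧   ≡⟨ cong (_* ⟦ k ⟧) (ι-* m n) ⟨
    ⟦ m ℕ.* n ⟧ * ⟦ k ⟧       ≡⟨ ι-* (m ℕ.* n) k ⟨
    ⟦ m ℕ.* n ℕ.* k ⟧         ≡⟨ cong ⟦_⟧ (ℕₚ.*-assoc m n k) ⟩
    ⟦ m ℕ.* (n ℕ.* k) ⟧       ≡⟨ ι-* m (n ℕ.* k) ⟩
    ⟦ m ⟧ * ⟦ n ℕ.* k ⟧       ≡⟨ cong (⟦ m ⟧ *_) (ι-* n k) ⟩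
    ⟦ m ⟧ * (⟦ n ⟧ * ⟦ k ⟧)   ∎

  *-distribʳ-+ : ∀ a b c → (a + b) * c ≡ a * c + b * c
  *-distribʳ-+ = ι-elim₃ (λ a b c → (a + b) * c ≡ a * c + b * c) λ m n k → begin
    (⟦ m ⟧ + ⟦ n ⟧) * ⟦ k ⟧   ≡⟨ cong (_* ⟦ k ⟧) (ι-+ m n) ⟨
    ⟦ m ℕ.+ n ⟧ * ⟦ k ⟧       ≡⟨ ι-* (m ℕ.+ n) k ⟨
    ⟦ (m ℕ.+ n) ℕ.* k ⟧       ≡⟨ cong ⟦_⟧ (ℕₚ.*-distribʳ-+ k m n) ⟩
    ⟦ m ℕ.* k ℕ.+ n ℕ.* k ⟧   ≡⟨ ι-+ (m ℕ.* k) (n ℕ.* k) ⟩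
    ⟦ m ℕ.* k ⟧ + ⟦ n ℕ.* k ⟧ ≡⟨ cong₂ _+_ (ι-* m k) (ι-* n k) ⟩
    ⟦ m ⟧ * ⟦ k ⟧ + ⟦ n ⟧ * ⟦ k ⟧ ∎

  -- commutativity holds already on representatives
  +-comm : ∀ a b → a + b ≡ b + a
  +-comm a b = cong ⟦_⟧ (ℕₚ.+-comm (toℕ a) (toℕ b))

  *-comm : ∀ a b → a * b ≡ b * a
  *-comm a b = cong ⟦_⟧ (ℕₚ.*-comm (toℕ a) (toℕ b))

  +-identityˡ : ∀ a → 0F p + a ≡ a
  +-identityˡ = ι-elim _ λ n → sym (ι-+ 0 n)

  *-identityˡ : ∀ a → 1F p * a ≡ a
  *-identityˡ = ι-elim _ λ n → trans (sym (ι-* 1 n)) (cong ⟦_⟧ (ℕₚ.*-identityˡ n))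

  -‿inverseʳ : ∀ a → a + -F_ p a ≡ 0F p
  -‿inverseʳ a = begin
    a + ⟦ p ℕ.∸ toℕ a ⟧             ≡⟨ cong (_+ ⟦ p ℕ.∸ toℕ a ⟧) (ι-toℕ a) ⟨
    ⟦ toℕ a ⟧ + ⟦ p ℕ.∸ toℕ a ⟧     ≡⟨ ι-+ (toℕ a) (p ℕ.∸ toℕ a) ⟨
    ⟦ toℕ a ℕ.+ (p ℕ.∸ toℕ a) ⟧     ≡⟨ cong ⟦_⟧ (ℕₚ.m+[n∸m]≡n (ℕₚ.<⇒≤ (toℕ<n a))) ⟩
    ⟦ p ⟧                           ≡⟨ ι-cong (trans (n%n≡0 p) (sym (m<n⇒m%n≡m (ℕ.>-nonZero⁻¹ p)))) ⟩
    ⟦ 0 ⟧                           ∎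

  𝔽-commutativeRing : CommutativeRing _ _
  𝔽-commutativeRing = record
    { Carrier = 𝔽 p ; _≈_ = _≡_ ; _+_ = _+_ ; _*_ = _*_ ; -_ = -F_ p ; 0# = 0F p ; 1# = 1F p
    ; isCommutativeRing = record
      { isRing = record
        { +-isAbelianGroup = record
          { isGroup = record
            { isMonoid = record
              { isSemigroup = record
                { isMagma = record { isEquivalence = isEquivalence ; ∙-cong = cong₂ _+_ }
                ; assoc = +-assoc }
              ; identity = comm∧idˡ⇒id +-comm +-identityˡ }
            ; inverse = comm∧invʳ⇒inv +-comm -‿inverseʳ
            ; ⁻¹-cong = cong (-F_ p) }
          ; comm = +-comm }
        ; *-cong = cong₂ _*_
        ; *-assoc = *-assoc
        ; *-identity = comm∧idˡ⇒id *-comm *-identityˡ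
        ; distrib = comm∧distrʳ⇒distrˡ *-comm distribʳ , distribʳ }
      ; *-comm = *-comm } }
    where
    distribʳ : ∀ c a b → (a + b) * c ≡ a * c + b * c
    distribʳ c a b = *-distribʳ-+ a b c

  open RingProperties (CommutativeRing.ring 𝔽-commutativeRing) public
    using (-‿involutive; -0#≈0#; -‿distribˡ-*; -‿distribʳ-*; +-inverseˡ-unique; +-inverseʳ-unique; +-cancelʳ;
           //-rightDividesˡ; //-rightDividesʳ)

  -- For prime p every nonzero element is invertible (Bézout's identity for p, toℕ a).
  inverse : Prime p → ∀ a → ¬ (a ≡ 0F p) → Σ (𝔽 p) λ b → b * a ≡ 1F p
  inverse p-prime a a≢0 with coprime-Bézout (prime⇒coprime p-prime {{a≢0⇒nonZero}} (toℕ<n a))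
    where
    a≢0⇒nonZero : NonZero (toℕ a)
    a≢0⇒nonZero = ≢-nonZero λ a≡0 → a≢0 (trans (sym (ι-toℕ a)) (cong ⟦_⟧ a≡0))
  ... | Bézout.+- x y 1+ya≡xp = -F_ p ⟦ y ⟧ , (begin
    -F_ p ⟦ y ⟧ * a            ≡⟨ -‿distribˡ-* ⟦ y ⟧ a ⟨
    -F_ p (⟦ y ⟧ * a)          ≡⟨ cong (-F_ p) ya≡-1 ⟩
    -F_ p (-F_ p ⟦ 1 ⟧)        ≡⟨ -‿involutive ⟦ 1 ⟧ ⟩
    ⟦ 1 ⟧                      ∎)
    where
    1+ya≡0 : ⟦ 1 ⟧ + ⟦ y ⟧ * a ≡ 0F p
    1+ya≡0 = begin
      ⟦ 1 ⟧ + ⟦ y ⟧ * a          ≡⟨ cong (λ b → ⟦ 1 ⟧ + ⟦ y ⟧ * b) (ι-toℕ a) ⟨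
      ⟦ 1 ⟧ + ⟦ y ⟧ * ⟦ toℕ a ⟧  ≡⟨ cong (⟦ 1 ⟧ +_) (ι-* y (toℕ a)) ⟨
      ⟦ 1 ⟧ + ⟦ y ℕ.* toℕ a ⟧    ≡⟨ ι-+ 1 (y ℕ.* toℕ a) ⟨
      ⟦ 1 ℕ.+ y ℕ.* toℕ a ⟧      ≡⟨ cong ⟦_⟧ 1+ya≡xp ⟩
      ⟦ x ℕ.* p ⟧                ≡⟨ ι-cong ([m+kn]%n≡m%n 0 x p) ⟩
      ⟦ 0 ⟧                      ∎
    ya≡-1 : ⟦ y ⟧ * a ≡ -F_ p ⟦ 1 ⟧
    ya≡-1 = +-inverseʳ-unique ⟦ 1 ⟧ (⟦ y ⟧ * a) 1+ya≡0
  ... | Bézout.-+ x y 1+xp≡ya = ⟦ y ⟧ , (begin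
    ⟦ y ⟧ * a                  ≡⟨ cong (⟦ y ⟧ *_) (ι-toℕ a) ⟨
    ⟦ y ⟧ * ⟦ toℕ a ⟧          ≡⟨ ι-* y (toℕ a) ⟨
    ⟦ y ℕ.* toℕ a ⟧            ≡⟨ cong ⟦_⟧ 1+xp≡ya ⟨
    ⟦ 1 ℕ.+ x ℕ.* p ⟧          ≡⟨ ι-cong ([m+kn]%n≡m%n 1 x p) ⟩
    ⟦ 1 ⟧                      ∎)

module Linear (p : ℕ) .{{_ : NonZero p}} where

  open PrimeField p
  open CommutativeRing 𝔽-commutativeRing
    using (_+_; _*_; 0#; semiring; distribˡ)
  open SemiringSum semiring using (sum; sum-cong-≗; sum-replicate-zero; ∑-distrib-+; ∑-comm; *-distribˡ-sum)
  open ≡-Reasoning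

  ΣF≡sum : ∀ {k} (f : Fin k → 𝔽 p) → ΣF p f ≡ sum f
  ΣF≡sum {zero}  f = refl
  ΣF≡sum {suc k} f = cong (f fz +_) (ΣF≡sum (f ∘ fs))

  ΣF-cong : ∀ {k} {f g : Fin k → 𝔽 p} → (∀ i → f i ≡ g i) → ΣF p f ≡ ΣF p g
  ΣF-cong {f = f} {g} f≗g = begin
    ΣF p f   ≡⟨ ΣF≡sum f ⟩
    sum f    ≡⟨ sum-cong-≗ f≗g ⟩
    sum g    ≡⟨ ΣF≡sum g ⟨
    ΣF p g   ∎

  ΣF-zero : ∀ k → ΣF p {k} (λ _ → 0#) ≡ 0#
  ΣF-zero k = trans (ΣF≡sum {k} (λ _ → 0#)) (sum-replicate-zero k)

  ΣF-+ : ∀ {k} (f g : Fin k → 𝔽 p) → ΣF p (λ i → f i + g i) ≡ ΣF p f + ΣF p g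
  ΣF-+ f g = begin
    ΣF p (λ i → f i + g i) ≡⟨ ΣF≡sum (λ i → f i + g i) ⟩
    sum (λ i → f i + g i)  ≡⟨ ∑-distrib-+ f g ⟩
    sum f + sum g          ≡⟨ cong₂ _+_ (ΣF≡sum f) (ΣF≡sum g) ⟨
    ΣF p f + ΣF p g        ∎

  ΣF-*ˡ : ∀ {k} c (f : Fin k → 𝔽 p) → c * ΣF p f ≡ ΣF p (λ i → c * f i)
  ΣF-*ˡ c f = begin
    c * ΣF p f              ≡⟨ cong (c *_) (ΣF≡sum f) ⟩
    c * sum f               ≡⟨ *-distribˡ-sum c f ⟩
    sum (λ i → c * f i)     ≡⟨ ΣF≡sum (λ i → c * f i) ⟨
    ΣF p (λ i → c * f i)    ∎

  ΣF-swap : ∀ {k m} (h : Fin k → Fin m → 𝔽 p) →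
    ΣF p (λ i → ΣF p (λ j → h i j)) ≡ ΣF p (λ j → ΣF p (λ i → h i j))
  ΣF-swap h = begin
    ΣF p (λ i → ΣF p (h i))             ≡⟨ ΣF-cong (λ i → ΣF≡sum (h i)) ⟩
    ΣF p (λ i → sum (h i))              ≡⟨ ΣF≡sum (λ i → sum (h i)) ⟩
    sum (λ i → sum (h i))               ≡⟨ ∑-comm h ⟩
    sum (λ j → sum (λ i → h i j))       ≡⟨ ΣF≡sum (λ j → sum (λ i → h i j)) ⟨
    ΣF p (λ j → sum (λ i → h i j))      ≡⟨ ΣF-cong (λ j → ΣF≡sum (λ i → h i j)) ⟨
    ΣF p (λ j → ΣF p (λ i → h i j))     ∎

  ΣF-*ʳ : ∀ {k} c (f : Fin k → 𝔽 p) → ΣF p f * c ≡ ΣF p (λ i → f i * c)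
  ΣF-*ʳ c f = begin
    ΣF p f * c             ≡⟨ *-comm (ΣF p f) c ⟩
    c * ΣF p f             ≡⟨ ΣF-*ˡ c f ⟩
    ΣF p (λ i → c * f i)   ≡⟨ ΣF-cong (λ i → *-comm c (f i)) ⟩
    ΣF p (λ i → f i * c)   ∎

  infix 4 _≋_
  _≋_ : ∀ {ℓ} → Vecℓ p ℓ → Vecℓ p ℓ → Set
  _≋_ = _≈_ p

  InSpanOf : ∀ {ℓ d} → (Fin d → Vecℓ p ℓ) → Vecℓ p ℓ → Set
  InSpanOf b v = Σ (Fin _ → 𝔽 p) λ c → v ≋ lincomb p c b

  lincomb-cong : ∀ {ℓ k} {c c′ : Fin k → 𝔽 p} (w : Fin k → Vecℓ p ℓ) →
    (∀ i → c i ≡ c′ i) → lincomb p c w ≋ lincomb p c′ w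
  lincomb-cong w c≗c′ j = ΣF-cong (λ i → cong (_* w i j) (c≗c′ i))

  lincomb-scale : ∀ {ℓ k} (s : Fin ℓ → 𝔽 p) (c : Fin k → 𝔽 p) (w : Fin k → Vecℓ p ℓ) →
    ∀ j → s j * lincomb p c w j ≡ lincomb p c (λ i j → s j * w i j) j
  lincomb-scale s c w j = begin
    s j * ΣF p (λ i → c i * w i j)     ≡⟨ ΣF-*ˡ (s j) (λ i → c i * w i j) ⟩
    ΣF p (λ i → s j * (c i * w i j))   ≡⟨ ΣF-cong (λ i → x[yz]≡y[xz] (s j) (c i) (w i j)) ⟩
    ΣF p (λ i → c i * (s j * w i j))   ∎
    where
    x[yz]≡y[xz] : ∀ x y z → x * (y * z) ≡ y * (x * z)
    x[yz]≡y[xz] x y z = begin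
      x * (y * z) ≡⟨ *-assoc x y z ⟨
      x * y * z   ≡⟨ cong (_* z) (*-comm x y) ⟩
      y * x * z   ≡⟨ *-assoc y x z ⟩
      y * (x * z) ∎

  lincomb-lincomb : ∀ {ℓ k d} (c : Fin k → 𝔽 p) (w : Fin k → Vecℓ p ℓ) (b : Fin d → Vecℓ p ℓ)
    (e : Fin k → Fin d → 𝔽 p) → (∀ i → w i ≋ lincomb p (e i) b) →
    lincomb p c w ≋ lincomb p (λ j → ΣF p (λ i → c i * e i j)) b
  lincomb-lincomb c w b e w≋eb m = begin
    ΣF p (λ i → c i * w i m)                            ≡⟨ ΣF-cong (λ i → cong (c i *_) (w≋eb i m)) ⟩
    ΣF p (λ i → c i * ΣF p (λ j → e i j * b j m))       ≡⟨ ΣF-cong (λ i → ΣF-*ˡ (c i) (λ j → e i j * b j m)) ⟩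
    ΣF p (λ i → ΣF p (λ j → c i * (e i j * b j m)))     ≡⟨ ΣF-swap (λ i j → c i * (e i j * b j m)) ⟩
    ΣF p (λ j → ΣF p (λ i → c i * (e i j * b j m)))     ≡⟨ ΣF-cong (λ j → ΣF-cong (λ i → *-assoc (c i) (e i j) (b j m))) ⟨
    ΣF p (λ j → ΣF p (λ i → c i * e i j * b j m))       ≡⟨ ΣF-cong (λ j → ΣF-*ʳ (b j m) (λ i → c i * e i j)) ⟨
    ΣF p (λ j → ΣF p (λ i → c i * e i j) * b j m)       ∎

  InSpanOf-lincomb : ∀ {ℓ k d} (b : Fin d → Vecℓ p ℓ) (c : Fin k → 𝔽 p) (w : Fin k → Vecℓ p ℓ) →
    (∀ i → InSpanOf b (w i)) → InSpanOf b (lincomb p c w)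
  InSpanOf-lincomb b c w w∈b =
    (λ j → ΣF p (λ i → c i * proj₁ (w∈b i) j)) , lincomb-lincomb c w b (proj₁ ∘ w∈b) (proj₂ ∘ w∈b)

  InSpanOf-resp : ∀ {ℓ d} (b : Fin d → Vecℓ p ℓ) {u v} → u ≋ v → InSpanOf b u → InSpanOf b v
  InSpanOf-resp b u≋v (c , u≋cb) = c , λ j → trans (sym (u≋v j)) (u≋cb j)

  dot-⊕ : ∀ {ℓ} (a u v : Vecℓ p ℓ) → dot p a (_⊕_ p u v) ≡ dot p a u + dot p a v
  dot-⊕ a u v = trans (ΣF-cong (λ i → distribˡ (a i) (u i) (v i))) (ΣF-+ (λ i → a i * u i) (λ i → a i * v i))

-- Over the field 𝔽 p every decidable set of vectors has a span of some finite
-- dimension: a basis is found greedily by scanning all p ^ ℓ vectors.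
module Dimension (p : ℕ) .{{_ : NonZero p}} (p-prime : Prime p) where

  open PrimeField p
  open Linear p
  open CommutativeRing 𝔽-commutativeRing
    using (_+_; _*_; -_; 0#; 1#; +-identityʳ; zeroˡ)
  open ≡-Reasoning

  -- membership in the span of an explicit family is decidable: try every coefficient vector
  InSpanOf? : ∀ {ℓ d} (b : Fin d → Vecℓ p ℓ) v → Dec (InSpanOf b v)
  InSpanOf? b v = map′ (λ (k , v≋kb) → finToFun k , v≋kb) code
    (any? λ k → all? λ j → v j ≟ lincomb p (finToFun k) b j)
    where
    code : InSpanOf b v → ∃ λ k → v ≋ lincomb p (finToFun k) b
    code (c , v≋cb) = funToFin c , λ j →
      trans (v≋cb j) (lincomb-cong b (λ i → sym (finToFun-funToFin c i)) j)

  InSpanOf-∷ : ∀ {ℓ d} (w : Vecℓ p ℓ) (b : Fin d → Vecℓ p ℓ) {v} → InSpanOf b v → InSpanOf (w ∷ b) v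
  InSpanOf-∷ w b (c , v≋cb) = (0# ∷ c) , λ j → trans (v≋cb j) (sym (begin
    0# * w j + lincomb p c b j   ≡⟨ cong (_+ lincomb p c b j) (zeroˡ (w j)) ⟩
    0# + lincomb p c b j         ≡⟨ +-identityˡ (lincomb p c b j) ⟩
    lincomb p c b j              ∎))

  InSpanOf-head : ∀ {ℓ d} (w : Vecℓ p ℓ) (b : Fin d → Vecℓ p ℓ) → InSpanOf (w ∷ b) w
  InSpanOf-head {d = d} w b = (1# ∷ λ _ → 0#) , λ j → sym (begin
    1# * w j + ΣF p (λ i → 0# * b i j)   ≡⟨ cong₂ _+_ (*-identityˡ (w j)) (ΣF-cong (λ i → zeroˡ (b i j))) ⟩
    w j + ΣF p {d} (λ _ → 0#)            ≡⟨ cong (w j +_) (ΣF-zero d) ⟩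
    w j + 0#                             ≡⟨ +-identityʳ (w j) ⟩
    w j                                  ∎)

  LinIndep-∷ : ∀ {ℓ d} (w : Vecℓ p ℓ) (b : Fin d → Vecℓ p ℓ) →
    LinIndep p b → ¬ InSpanOf b w → LinIndep p (w ∷ b)
  LinIndep-∷ w b b-indep w∉b c c[w∷b]≋0 with c fz ≟ 0#
  ... | yes c₀≡0 = λ { fz → c₀≡0 ; (fs i) → b-indep (c ∘ fs) tail≋0 i }
    where
    tail≋0 : lincomb p (c ∘ fs) b ≋ 0V p
    tail≋0 j = begin
      lincomb p (c ∘ fs) b j                  ≡⟨ +-identityˡ _ ⟨
      0# + lincomb p (c ∘ fs) b j             ≡⟨ cong (_+ lincomb p (c ∘ fs) b j) (trans (sym (zeroˡ (w j))) (cong (_* w j) (sym c₀≡0))) ⟩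
      c fz * w j + lincomb p (c ∘ fs) b j     ≡⟨ c[w∷b]≋0 j ⟩
      0#                                      ∎
  ... | no c₀≢0 = ⊥-elim (w∉b ((λ i → - u * c (fs i)) , w≋rest))
    where
    u = proj₁ (inverse p-prime (c fz) c₀≢0)
    uc₀≡1 = proj₂ (inverse p-prime (c fz) c₀≢0)
    L = lincomb p (c ∘ fs) b
    w≋rest : w ≋ lincomb p (λ i → - u * c (fs i)) b
    w≋rest j = begin
      w j                          ≡⟨ *-identityˡ (w j) ⟨
      1# * w j                     ≡⟨ cong (_* w j) uc₀≡1 ⟨
      u * c fz * w j               ≡⟨ *-assoc u (c fz) (w j) ⟩
      u * (c fz * w j)             ≡⟨ cong (u *_) (+-inverseˡ-unique (c fz * w j) (L j) (c[w∷b]≋0 j)) ⟩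
      u * - L j                    ≡⟨ -‿distribʳ-* u (L j) ⟨
      - (u * L j)                  ≡⟨ -‿distribˡ-* u (L j) ⟩
      - u * L j                    ≡⟨ ΣF-*ˡ (- u) (λ i → c (fs i) * b i j) ⟩
      ΣF p (λ i → - u * (c (fs i) * b i j))  ≡⟨ ΣF-cong (λ i → *-assoc (- u) (c (fs i)) (b i j)) ⟨
      lincomb p (λ i → - u * c (fs i)) b j   ∎

  module Greedy {ℓ} (P : Vecℓ p ℓ → Set) (P? : ∀ v → Dec (P v))
                (P-resp : ∀ {u v} → u ≋ v → P u → P v) where

    record Partial : Set where
      constructor partial
      field
        size        : ℕ
        basis       : Fin size → Vecℓ p ℓ
        basis∈span  : ∀ i → InSpan p P (basis i)
        independent : LinIndep p basis
    open Partial

    _⊑_ : Partial → Partial → Set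
    s ⊑ s′ = ∀ {v} → InSpanOf (basis s) v → InSpanOf (basis s′) v

    InSpan-single : ∀ {v} → P v → InSpan p P v
    InSpan-single {v} Pv = 1 , (λ _ → v) , (λ _ → Pv) , (λ _ → 1#) ,
      λ j → sym (trans (+-identityʳ (1# * v j)) (*-identityˡ (v j)))

    step : (s : Partial) (w : Vecℓ p ℓ) → Σ Partial λ s′ → s ⊑ s′ × (P w → InSpanOf (basis s′) w)
    step s w with P? w
    ... | no ¬Pw = s , (λ v∈s → v∈s) , λ Pw → ⊥-elim (¬Pw Pw)
    ... | yes Pw with InSpanOf? (basis s) w
    ...   | yes w∈s = s , (λ v∈s → v∈s) , λ _ → w∈s
    ...   | no w∉s = s′ , InSpanOf-∷ w (basis s) , λ _ → InSpanOf-head w (basis s)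
      where
      s′ = partial (suc (size s)) (w ∷ basis s)
             (λ { fz → InSpan-single Pw ; (fs i) → basis∈span s i })
             (LinIndep-∷ w (basis s) (independent s) w∉s)

    scan : (s : Partial) {N : ℕ} (enum : Fin N → Vecℓ p ℓ) →
      Σ Partial λ s′ → s ⊑ s′ × (∀ k → P (enum k) → InSpanOf (basis s′) (enum k))
    scan s {zero} enum = s , (λ v∈s → v∈s) , λ ()
    scan s {suc N} enum with step s (enum fz)
    ... | s₁ , s⊑s₁ , head∈s₁ with scan s₁ (enum ∘ fs)
    ...   | s₂ , s₁⊑s₂ , tail∈s₂ =
      s₂ , (λ v∈s → s₁⊑s₂ (s⊑s₁ v∈s)) , λ { fz Pv → s₁⊑s₂ (head∈s₁ Pv) ; (fs k) → tail∈s₂ k }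

    dimension-exists : Σ ℕ (DimSpan p P)
    dimension-exists = size s , basis s , basis∈span s , independent s , spanning
      where
      scanned = scan (partial 0 (λ ()) (λ ()) (λ _ _ ())) (finToFun {m = p} {n = ℓ})
      s = proj₁ scanned
      P⊆span : ∀ {v} → P v → InSpanOf (basis s) v
      P⊆span {v} Pv = InSpanOf-resp (basis s) (finToFun-funToFin v)
        (proj₂ (proj₂ scanned) (funToFin v) (P-resp (λ j → sym (finToFun-funToFin v j)) Pv))
      spanning : ∀ v → InSpan p P v → InSpanOf (basis s) v
      spanning v (k , w , Pw , c , v≋cw) =
        InSpanOf-resp (basis s) (λ j → sym (v≋cw j)) (InSpanOf-lincomb (basis s) c w (P⊆span ∘ Pw))

  -- the sets 𝒮^α_C are decidable and closed under ≋, so dim(C) always exists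
  𝒮? : ∀ {ℓ} (C : Vecℓ p ℓ) α v → Dec (𝒮 p C α v)
  𝒮? C α v = all? (λ i → (v i ≟ 0#) ⊎-dec (v i ≟ 1#)) ×-dec (dot p C v ≟ α)

  𝒮-resp : ∀ {ℓ} (C : Vecℓ p ℓ) α {u v} → u ≋ v → 𝒮 p C α u → 𝒮 p C α v
  𝒮-resp C α u≋v (u-bin , Cu≡α) =
    (λ i → subst (λ z → (z ≡ 0#) ⊎ (z ≡ 1#)) (u≋v i) (u-bin i)) ,
    trans (ΣF-cong (λ i → cong (C i *_) (sym (u≋v i)))) Cu≡α

  dimC-exists : ∀ {ℓ} (C : Vecℓ p ℓ) → Σ ℕ (DimC p C)
  dimC-exists C = Greedy.dimension-exists (𝒮 p C 0#) (𝒮? C 0#) (𝒮-resp C 0#)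

-- The set Σ(A) of subset sums grows
-- strictly with every new element unless it is closed under adding that element,
-- in which case it is all of 𝔽 p.
module SubsetSums (p : ℕ) .{{_ : NonZero p}} (p-prime : Prime p) where

  open PrimeField p
  open CommutativeRing 𝔽-commutativeRing
    using (_+_; _*_; -_; 0#; 1#; zeroˡ; zeroʳ; *-identityʳ)
  open ≡-Reasoning

  -- a set containing 0 and closed under adding a nonzero a is all of 𝔽 p,
  -- since every x equals k · a for k = x · a⁻¹
  closed⇒full : (Q : 𝔽 p → Set) (a : 𝔽 p) → ¬ (a ≡ 0#) →
    Q 0# → (∀ y → Q y → Q (y + a)) → ∀ x → Q x
  closed⇒full Q a a≢0 Q0 Q+a x = subst Q ka≡x (multiples (toℕ (x * a⁻¹)))
    where
    a⁻¹ = proj₁ (inverse p-prime a a≢0)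
    multiples : ∀ k → Q (ι p k * a)
    multiples zero    = subst Q (sym (zeroˡ a)) Q0
    multiples (suc k) = subst Q (sym (begin
      ι p (suc k) * a           ≡⟨ cong (_* a) (ι-+ 1 k) ⟩
      (1# + ι p k) * a          ≡⟨ *-distribʳ-+ 1# (ι p k) a ⟩
      1# * a + ι p k * a        ≡⟨ cong (_+ ι p k * a) (*-identityˡ a) ⟩
      a + ι p k * a             ≡⟨ +-comm a (ι p k * a) ⟩
      ι p k * a + a             ∎)) (Q+a _ (multiples k))
    ka≡x : ι p (toℕ (x * a⁻¹)) * a ≡ x
    ka≡x = begin
      ι p (toℕ (x * a⁻¹)) * a   ≡⟨ cong (_* a) (ι-toℕ (x * a⁻¹)) ⟩
      x * a⁻¹ * a               ≡⟨ *-assoc x a⁻¹ a ⟩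
      x * (a⁻¹ * a)             ≡⟨ cong (x *_) (proj₂ (inverse p-prime a a≢0)) ⟩
      x * 1#                    ≡⟨ *-identityʳ x ⟩
      x                         ∎

  _⊞_ : Subset p → 𝔽 p → Subset p
  X ⊞ a = tabulate (λ x → lookup X (x + - a))

  ∈⊞⁻ : ∀ {X a x} → x ∈ X ⊞ a → x + - a ∈ X
  ∈⊞⁻ {X} {a} {x} x∈X+a =
    lookup⇒[]= _ X (trans (sym (lookup∘tabulate (λ y → lookup X (y + - a)) x)) ([]=⇒lookup x∈X+a))

  ∈⊞⁺ : ∀ {X a y} → y ∈ X → y + a ∈ X ⊞ a
  ∈⊞⁺ {X} {a} {y} y∈X = lookup⇒[]= (y + a) (X ⊞ a) (begin
    lookup (X ⊞ a) (y + a)       ≡⟨ lookup∘tabulate (λ x → lookup X (x + - a)) (y + a) ⟩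
    lookup X (y + a + - a)       ≡⟨ cong (lookup X) (//-rightDividesʳ a y) ⟩
    lookup X y                   ≡⟨ []=⇒lookup y∈X ⟩
    true                         ∎)

  sums : ∀ {ℓ} → Vecℓ p ℓ → Subset p
  sums {zero}  A = ⁅ 0# ⁆
  sums {suc ℓ} A = sums (A ∘ fs) ∪ (sums (A ∘ fs) ⊞ A fz)

  sums-sound : ∀ {ℓ} (A : Vecℓ p ℓ) {x} → x ∈ sums A → Σ (Vecℓ p ℓ) (𝒮 p A x)
  sums-sound {zero}  A {x} x∈⁅0⁆ = (λ ()) , (λ ()) , sym (x∈⁅y⁆⇒x≡y 0# x∈⁅0⁆)
  sums-sound {suc ℓ} A {x} x∈Σ with x∈p∪q⁻ (sums (A ∘ fs)) _ x∈Σ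
  ... | inj₁ x∈Σ′ with sums-sound (A ∘ fs) x∈Σ′
  ...   | y , y-bin , Ay≡x = (0# ∷ y) , (λ { fz → inj₁ refl ; (fs i) → y-bin i }) , (begin
    A fz * 0# + dot p (A ∘ fs) y  ≡⟨ cong₂ _+_ (zeroʳ (A fz)) Ay≡x ⟩
    0# + x                        ≡⟨ +-identityˡ x ⟩
    x                             ∎)
  sums-sound {suc ℓ} A {x} x∈Σ | inj₂ x∈Σ′+a with sums-sound (A ∘ fs) (∈⊞⁻ {a = A fz} x∈Σ′+a)
  ...   | y , y-bin , Ay≡x-a = (1# ∷ y) , (λ { fz → inj₂ refl ; (fs i) → y-bin i }) , (begin
    A fz * 1# + dot p (A ∘ fs) y  ≡⟨ cong₂ _+_ (*-identityʳ (A fz)) Ay≡x-a ⟩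
    A fz + (x + - A fz)           ≡⟨ +-comm (A fz) (x + - A fz) ⟩
    x + - A fz + A fz             ≡⟨ //-rightDividesˡ (A fz) x ⟩
    x                             ∎)

  0∈sums : ∀ {ℓ} (A : Vecℓ p ℓ) → 0# ∈ sums A
  0∈sums {zero}  A = x∈⁅x⁆ 0#
  0∈sums {suc ℓ} A = x∈p∪q⁺ (inj₁ (0∈sums (A ∘ fs)))

  extend-grows : (X : Subset p) (a : 𝔽 p) → ¬ (a ≡ 0#) → 0# ∈ X →
    (∀ x → x ∈ X) ⊎ (X ⊂ X ∪ (X ⊞ a))
  extend-grows X a a≢0 0∈X with any? {P = λ y → y ∈ X × y + a ∉ X} (λ y → (y ∈? X) ×-dec ¬? (y + a ∈? X))
  ... | yes (y , y∈X , y+a∉X) = inj₂ (p⊆p∪q (X ⊞ a) , y + a , x∈p∪q⁺ (inj₂ (∈⊞⁺ y∈X)) , y+a∉X)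
  ... | no ¬escape = inj₁ (closed⇒full (_∈ X) a a≢0 0∈X closed)
    where
    closed : ∀ y → y ∈ X → y + a ∈ X
    closed y y∈X with y + a ∈? X
    ... | yes y+a∈X = y+a∈X
    ... | no y+a∉X = ⊥-elim (¬escape (y , y∈X , y+a∉X))

  sums-grow : ∀ {ℓ} (A : Vecℓ p ℓ) → (∀ i → ¬ (A i ≡ 0#)) →
    (∀ x → x ∈ sums A) ⊎ (suc ℓ ≤ ∣ sums A ∣)
  sums-grow {zero} A A≢0 = inj₂ (ℕₚ.≤-reflexive (sym (∣⁅x⁆∣≡1 0#)))
  sums-grow {suc ℓ} A A≢0 with sums-grow (A ∘ fs) (A≢0 ∘ fs)
  ... | inj₁ Σ′-full = inj₁ (λ x → x∈p∪q⁺ (inj₁ (Σ′-full x)))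
  ... | inj₂ ℓ<∣Σ′∣ with extend-grows (sums (A ∘ fs)) (A fz) (A≢0 fz) (0∈sums (A ∘ fs))
  ...   | inj₁ Σ′-full = inj₁ (λ x → x∈p∪q⁺ (inj₁ (Σ′-full x)))
  ...   | inj₂ Σ′⊂Σ = inj₂ (ℕₚ.≤-trans (s≤s ℓ<∣Σ′∣) (p⊂q⇒∣p∣<∣q∣ Σ′⊂Σ))

  subset-sum-exists : ∀ {ℓ} → p ∸ 1 ≤ ℓ → (A : Vecℓ p ℓ) → (∀ i → ¬ (A i ≡ 0#)) →
    ∀ α → Σ (Vecℓ p ℓ) (𝒮 p A α)
  subset-sum-exists {ℓ} p-1≤ℓ A A≢0 α with sums-grow A A≢0
  ... | inj₁ Σ-full = sums-sound A (Σ-full α)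
  ... | inj₂ ℓ<∣Σ∣ = sums-sound A (subst (α ∈_) (sym (∣p∣≡n⇒p≡⊤ ∣Σ∣≡p)) ∈⊤)
    where
    ∣Σ∣≡p : ∣ sums A ∣ ≡ p
    ∣Σ∣≡p = ℕₚ.≤-antisym (∣p∣≤n (sums A))
      (ℕₚ.≤-trans (ℕₚ.m≤n+m∸n p 1) (ℕₚ.≤-trans (s≤s p-1≤ℓ) ℓ<∣Σ∣))

module Transfer (p : ℕ) .{{_ : NonZero p}} where

  open PrimeField p
  open Linear p
  open CommutativeRing 𝔽-commutativeRing
    using (_+_; _*_; -_; 0#; 1#; +-identityʳ; zeroʳ; distribˡ)
  open ≡-Reasoning

  scale : ∀ {ℓ} → (Fin ℓ → 𝔽 p) → Vecℓ p ℓ → Vecℓ p ℓ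
  scale σ u j = σ j * u j

  IsSign : ∀ {ℓ} → (Fin ℓ → 𝔽 p) → Set
  IsSign σ = ∀ j → σ j * σ j ≡ 1#

  scale-involutive : ∀ {ℓ} (σ : Fin ℓ → 𝔽 p) → IsSign σ → ∀ u → scale σ (scale σ u) ≋ u
  scale-involutive σ σ²≡1 u j = begin
    σ j * (σ j * u j)   ≡⟨ *-assoc (σ j) (σ j) (u j) ⟨
    σ j * σ j * u j     ≡⟨ cong (_* u j) (σ²≡1 j) ⟩
    1# * u j            ≡⟨ *-identityˡ (u j) ⟩
    u j                 ∎

  InSpanOf-scale : ∀ {ℓ d} (σ : Fin ℓ → 𝔽 p) (b : Fin d → Vecℓ p ℓ) {v} →
    InSpanOf b v → InSpanOf (scale σ ∘ b) (scale σ v)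
  InSpanOf-scale σ b (c , v≋cb) = c , λ j → trans (cong (σ j *_) (v≋cb j)) (lincomb-scale σ c b j)

  DimSpan-transfer : ∀ {ℓ d} {σ : Fin ℓ → 𝔽 p} (P Q : Vecℓ p ℓ → Set) → IsSign σ →
    (∀ u → Q u → InSpan p P (scale σ u)) → (∀ t → P t → Q (scale σ t)) →
    DimSpan p P d → DimSpan p Q d
  DimSpan-transfer {σ = σ} P Q σ²≡1 Q→P P→Q (b , b∈P , b-indep , P⊆b) =
    scale σ ∘ b , b′∈Q , b′-indep , Q⊆b′
    where
    b′∈Q : ∀ i → InSpan p Q (scale σ (b i))
    b′∈Q i with b∈P i
    ... | k , w , Pw , c , bi≋cw = k , scale σ ∘ w , (λ m → P→Q (w m) (Pw m)) , InSpanOf-scale σ w (c , bi≋cw)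
    b′-indep : LinIndep p (scale σ ∘ b)
    b′-indep c cb′≋0 = b-indep c λ j → begin
      lincomb p c b j                        ≡⟨ scale-involutive σ σ²≡1 (lincomb p c b) j ⟨
      σ j * (σ j * lincomb p c b j)          ≡⟨ cong (σ j *_) (trans (lincomb-scale σ c b j) (cb′≋0 j)) ⟩
      σ j * 0#                               ≡⟨ zeroʳ (σ j) ⟩
      0#                                     ∎
    Q⊆b′ : ∀ v → InSpan p Q v → InSpanOf (scale σ ∘ b) v
    Q⊆b′ v (k , w , Qw , c , v≋cw) = InSpanOf-resp (scale σ ∘ b) (λ j → sym (v≋cw j))
      (InSpanOf-lincomb (scale σ ∘ b) c w λ m →
        InSpanOf-resp (scale σ ∘ b) (scale-involutive σ σ²≡1 (w m))
          (InSpanOf-scale σ b (P⊆b (scale σ (w m)) (Q→P (w m) (Qw m)))))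

  _⊖_ : ∀ {ℓ} → Vecℓ p ℓ → Vecℓ p ℓ → Vecℓ p ℓ
  (y ⊖ x) j = y j + - x j

  affine-shift : ∀ {ℓ k} (c : Fin k → 𝔽 p) (w : Fin k → Vecℓ p ℓ) (x : Vecℓ p ℓ) → ΣF p c ≡ 1# →
    ∀ j → lincomb p c (λ m → w m ⊖ x) j ≡ lincomb p c w j + - x j
  affine-shift c w x Σc≡1 j = begin
    ΣF p (λ m → c m * (w m j + - x j))             ≡⟨ ΣF-cong (λ m → distribˡ (c m) (w m j) (- x j)) ⟩
    ΣF p (λ m → c m * w m j + c m * - x j)         ≡⟨ ΣF-+ (λ m → c m * w m j) (λ m → c m * - x j) ⟩
    lincomb p c w j + ΣF p (λ m → c m * - x j)     ≡⟨ cong (lincomb p c w j +_) (ΣF-*ʳ (- x j) c) ⟨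
    lincomb p c w j + ΣF p c * - x j               ≡⟨ cong (λ s → lincomb p c w j + s * - x j) Σc≡1 ⟩
    lincomb p c w j + 1# * - x j                   ≡⟨ cong (lincomb p c w j +_) (*-identityˡ (- x j)) ⟩
    lincomb p c w j + - x j                        ∎

  InAffHull-single : ∀ {ℓ} {S : Vecℓ p ℓ → Set} {v} → S v → InAffHull p S v
  InAffHull-single {v = v} Sv = 1 , (λ _ → v) , (λ _ → Sv) , (λ _ → 1#) , +-identityʳ 1# ,
    λ j → sym (trans (+-identityʳ (1# * v j)) (*-identityˡ (v j)))

  DimAff-transfer : ∀ {ℓ d} (S T : Vecℓ p ℓ → Set) (σ : Fin ℓ → 𝔽 p) → IsSign σ →
    (x₀ : Vecℓ p ℓ) → S x₀ →
    (∀ y → S y → T (scale σ (y ⊖ x₀))) → (∀ t → T t → S (_⊕_ p (scale σ t) x₀)) →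
    DimSpan p T d → DimAff p S d
  DimAff-transfer S T σ σ²≡1 x₀ Sx₀ S→T T→S dimT =
    x₀ , InAffHull-single {S = S} Sx₀ , DimSpan-transfer {σ = σ} T Direction σ²≡1 Direction→T T→Direction dimT
    where
    Direction : Vecℓ p _ → Set
    Direction u = InAffHull p S (_⊕_ p u x₀)
    T→Direction : ∀ t → T t → Direction (scale σ t)
    T→Direction t Tt = InAffHull-single {S = S} (T→S t Tt)
    Direction→T : ∀ u → Direction u → InSpan p T (scale σ u)
    Direction→T u (k , w , Sw , c , Σc≡1 , u+x₀≋cw) =
      k , (λ m → scale σ (w m ⊖ x₀)) , (λ m → S→T (w m) (Sw m)) , c , λ j → begin
        σ j * u j                                ≡⟨ cong (σ j *_) (//-rightDividesʳ (x₀ j) (u j)) ⟨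
        σ j * (u j + x₀ j + - x₀ j)              ≡⟨ cong (λ z → σ j * (z + - x₀ j)) (u+x₀≋cw j) ⟩
        σ j * (lincomb p c w j + - x₀ j)         ≡⟨ cong (σ j *_) (affine-shift c w x₀ Σc≡1 j) ⟨
        σ j * lincomb p c (λ m → w m ⊖ x₀) j     ≡⟨ lincomb-scale σ c (λ m → w m ⊖ x₀) j ⟩
        lincomb p c (λ m → scale σ (w m ⊖ x₀)) j ∎

module SupportFlip (p : ℕ) .{{_ : NonZero p}} where

  open PrimeField p
  open Linear p
  open Transfer p
  open CommutativeRing 𝔽-commutativeRing
    using (_+_; _*_; -_; 0#; 1#; +-identityʳ; zeroʳ; *-identityʳ; -‿inverseˡ)
  open ≡-Reasoning

  Bit : 𝔽 p → Set
  Bit x = (x ≡ 0#) ⊎ (x ≡ 1#)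

  isOne : ∀ {x} → Bit x → Bool
  isOne (inj₁ _) = false
  isOne (inj₂ _) = true

  -- the sign 1 - 2x of a bit x
  sign : Bool → 𝔽 p
  sign false = 1#
  sign true  = - 1#

  sign² : ∀ b → sign b * sign b ≡ 1#
  sign² false = *-identityˡ 1#
  sign² true  = begin
    - 1# * - 1#       ≡⟨ -‿distribˡ-* 1# (- 1#) ⟨
    - (1# * - 1#)     ≡⟨ cong -_ (*-identityˡ (- 1#)) ⟩
    - (- 1#)          ≡⟨ -‿involutive 1# ⟩
    1#                ∎

  flip≡sign : ∀ b a → (if b then - a else a) ≡ sign b * a
  flip≡sign false a = sym (*-identityˡ a)
  flip≡sign true  a = trans (cong -_ (sym (*-identityˡ a))) (-‿distribˡ-* 1# a)

  bit-diff : ∀ {x y} (x-bit : Bit x) → Bit y → Bit (sign (isOne x-bit) * (y + - x))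
  bit-diff (inj₁ refl) (inj₁ refl) = inj₁ (trans (*-identityˡ _) (-‿inverseʳ 0#))
  bit-diff (inj₁ refl) (inj₂ refl) = inj₂ (trans (*-identityˡ _) (trans (cong (1# +_) -0#≈0#) (+-identityʳ 1#)))
  bit-diff (inj₂ refl) (inj₁ refl) = inj₂ (trans (cong (- 1# *_) (+-identityˡ (- 1#))) (sign² true))
  bit-diff (inj₂ refl) (inj₂ refl) = inj₁ (trans (cong (- 1# *_) (-‿inverseʳ 1#)) (zeroʳ (- 1#)))

  bit-shift : ∀ {x t} (x-bit : Bit x) → Bit t → Bit (sign (isOne x-bit) * t + x)
  bit-shift (inj₁ refl) (inj₁ refl) = inj₁ (trans (+-identityʳ _) (*-identityˡ 0#))
  bit-shift (inj₁ refl) (inj₂ refl) = inj₂ (trans (+-identityʳ _) (*-identityˡ 1#))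
  bit-shift (inj₂ refl) (inj₁ refl) = inj₂ (trans (cong (_+ 1#) (zeroʳ (- 1#))) (+-identityˡ 1#))
  bit-shift (inj₂ refl) (inj₂ refl) = inj₁ (trans (cong (_+ 1#) (*-identityʳ (- 1#))) (-‿inverseˡ 1#))

  module _ {ℓ} (A : Vecℓ p ℓ) (α : 𝔽 p) {x₀ : Vecℓ p ℓ} (x₀∈𝒮 : 𝒮 p A α x₀) where

    support : Subset ℓ
    support = tabulate (λ j → isOne (proj₁ x₀∈𝒮 j))

    σ : Fin ℓ → 𝔽 p
    σ j = sign (isOne (proj₁ x₀∈𝒮 j))

    σ²≡1 : IsSign σ
    σ²≡1 j = sign² (isOne (proj₁ x₀∈𝒮 j))

    C : Vecℓ p ℓ
    C = flipI p A support

    C≡σA : ∀ j → C j ≡ σ j * A j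
    C≡σA j = trans (cong (λ b → if b then - A j else A j) (lookup∘tabulate _ j)) (flip≡sign _ (A j))

    Cσ≡A : ∀ j z → C j * (σ j * z) ≡ A j * z
    Cσ≡A j z = begin
      C j * (σ j * z)           ≡⟨ cong (_* (σ j * z)) (C≡σA j) ⟩
      σ j * A j * (σ j * z)     ≡⟨ cong (_* (σ j * z)) (*-comm (σ j) (A j)) ⟩
      A j * σ j * (σ j * z)     ≡⟨ *-assoc (A j) (σ j) (σ j * z) ⟩
      A j * (σ j * (σ j * z))   ≡⟨ cong (A j *_) (scale-involutive σ σ²≡1 (λ _ → z) j) ⟩
      A j * z                   ∎

    𝒮A→𝒮C : ∀ y → 𝒮 p A α y → 𝒮 p C 0# (scale σ (y ⊖ x₀))
    𝒮A→𝒮C y (y-bin , Ay≡α) = (λ j → bit-diff (proj₁ x₀∈𝒮 j) (y-bin j)) , (begin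
      dot p C (scale σ (y ⊖ x₀))   ≡⟨ ΣF-cong (λ j → Cσ≡A j (y j + - x₀ j)) ⟩
      dot p A (y ⊖ x₀)             ≡⟨ +-cancelʳ α (dot p A (y ⊖ x₀)) 0# A[y-x₀]+α≡0+α ⟩
      0#                           ∎)
      where
      A[y-x₀]+α≡0+α : dot p A (y ⊖ x₀) + α ≡ 0# + α
      A[y-x₀]+α≡0+α = begin
        dot p A (y ⊖ x₀) + α                 ≡⟨ cong (dot p A (y ⊖ x₀) +_) (proj₂ x₀∈𝒮) ⟨
        dot p A (y ⊖ x₀) + dot p A x₀        ≡⟨ dot-⊕ A (y ⊖ x₀) x₀ ⟨
        dot p A (_⊕_ p (y ⊖ x₀) x₀)          ≡⟨ ΣF-cong (λ j → cong (A j *_) (//-rightDividesˡ (x₀ j) (y j))) ⟩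
        dot p A y                            ≡⟨ Ay≡α ⟩
        α                                    ≡⟨ +-identityˡ α ⟨
        0# + α                               ∎

    𝒮C→𝒮A : ∀ t → 𝒮 p C 0# t → 𝒮 p A α (_⊕_ p (scale σ t) x₀)
    𝒮C→𝒮A t (t-bin , Ct≡0) = (λ j → bit-shift (proj₁ x₀∈𝒮 j) (t-bin j)) , (begin
      dot p A (_⊕_ p (scale σ t) x₀)    ≡⟨ dot-⊕ A (scale σ t) x₀ ⟩
      dot p A (scale σ t) + dot p A x₀  ≡⟨ cong₂ _+_ (ΣF-cong Aσ≡C) (proj₂ x₀∈𝒮) ⟩
      dot p C t + α                     ≡⟨ cong (_+ α) Ct≡0 ⟩
      0# + α                            ≡⟨ +-identityˡ α ⟩
      α                                 ∎)
      where
      Aσ≡C : ∀ j → A j * (σ j * t j) ≡ C j * t j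
      Aσ≡C j = begin
        A j * (σ j * t j)   ≡⟨ *-assoc (A j) (σ j) (t j) ⟨
        A j * σ j * t j     ≡⟨ cong (_* t j) (trans (*-comm (A j) (σ j)) (sym (C≡σA j))) ⟩
        C j * t j           ∎

    support-dimension : ∀ {d} → DimC p C d → DimAα p A α d
    support-dimension = DimAff-transfer (𝒮 p A α) (𝒮 p C 0#) σ σ²≡1 x₀ x₀∈𝒮 𝒮A→𝒮C 𝒮C→𝒮A

lemma6p1 : (p : ℕ) .{{_ : NonZero p}} → Prime p →
    (ℓ : ℕ) → p ∸ 1 ≤ ℓ →
    (A : Vecℓ p ℓ) → (∀ i → ¬ (A i ≡ 0F p)) →
    (α : 𝔽 p) →
    Σ (Subset ℓ) λ I → Σ ℕ λ d → DimAα p A α d × DimC p (flipI p A I) d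
lemma6p1 p p-prime ℓ p-1≤ℓ A A≢0 α =
  let x₀ , x₀∈𝒮 = SubsetSums.subset-sum-exists p p-prime p-1≤ℓ A A≢0 α
      I = SupportFlip.support p A α x₀∈𝒮
      d , dim-A_I = Dimension.dimC-exists p p-prime (flipI p A I)
  in I , d , SupportFlip.support-dimension p A α x₀∈𝒮 dim-A_I , dim-A_I
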